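{- If $n\geq m\geq 2$ are integers, then $\chi_L(P_m\square P_n)=4$.
   Context: $P_k$ is the path on $k$ vertices and $\square$ is the cartesian product of graphs: $V(G\square H)=V(G)\times V(H)$, with $(a,b)\sim(a',b')$ iff ($a=a'$ and $bb'\in E(H)$) or ($aa'\in E(G)$ and $b=b'$). For a connected graph $G$, with $d$ the shortest-path distance and $d(v,S)=\min_{x\in S}d(v,x)$, a proper $k$-coloring with ordered color classes $(V_1,\dots,V_k)$ is a locating coloring if the color codes $(d(v,V_1),\dots,d(v,V_k))$ of distinct vertices $v$ are distinct; $\chi_L(G)$ is the minimum $k$ for which a locating $k$-coloring exists. -}

module Defs where

open import Data.Nat using (ℕ; zero; suc; _≤_)
open import Data.Fin using (Fin; toℕ)
open import Data.Product using (_×_; _,_; Σ; ∃; ∃-syntax)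
open import Data.Sum using (_⊎_)
open import Relation.Binary.PropositionalEquality using (_≡_; _≢_)
open import Function.Bundles using (_⇔_)

record Graph : Set₁ where
  field
    V   : Set
    Adj : V → V → Set
open Graph public

P : ℕ → Graph
P k = record { V = Fin k ; Adj = λ i j → (toℕ j ≡ suc (toℕ i)) ⊎ (toℕ i ≡ suc (toℕ j)) }

_□_ : Graph → Graph → Graph
G □ H = record
  { V   = V G × V H
  ; Adj = λ { (a , b) (a' , b') →
              (a ≡ a' × Adj H b b') ⊎ (Adj G a a' × b ≡ b') } }

data Walk (G : Graph) : V G → V G → ℕ → Set where
  here : ∀ {u} → Walk G u u zero
  step : ∀ {u w v ℓ} → Adj G u w → Walk G w v ℓ → Walk G u v (suc ℓ)

IsDist : (G : Graph) → V G → V G → ℕ → Set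
IsDist G u v δ = Walk G u v δ × (∀ ℓ → Walk G u v ℓ → δ ≤ ℓ)

IsSetDist : (G : Graph) → V G → (V G → Set) → ℕ → Set
IsSetDist G v S δ =
  (Σ (V G) λ x → S x × IsDist G v x δ) ×
  (∀ x → S x → ∀ ε → IsDist G v x ε → δ ≤ ε)

Coloring : Graph → ℕ → Set
Coloring G k = V G → Fin k

IsProper : (G : Graph) {k : ℕ} → Coloring G k → Set
IsProper G c = ∀ u v → Adj G u v → c u ≢ c v

-- u and v have the same color code (d(u,V_1),...,d(u,V_k)) = (d(v,V_1),...,d(v,V_k)).
SameCode : (G : Graph) {k : ℕ} → Coloring G k → V G → V G → Set
SameCode G c u v = ∀ i δ → IsSetDist G u (λ x → c x ≡ i) δ ⇔ IsSetDist G v (λ x → c x ≡ i) δ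

IsLocating : (G : Graph) {k : ℕ} → Coloring G k → Set
IsLocating G c = IsProper G c × (∀ u v → SameCode G c u v → u ≡ v)

HasLocatingColoring : Graph → ℕ → Set
HasLocatingColoring G k = Σ (Coloring G k) λ c → IsLocating G c

LocatingChromaticNumber : Graph → ℕ → Set
LocatingChromaticNumber G k =
  HasLocatingColoring G k × (∀ j → HasLocatingColoring G j → k ≤ j)

-- Upper bound: colour the corners (0,0) and (0,N) of the grid (N the last column) with their own colours and
-- every other vertex (x,y) by the parity of x + y. The two singleton classes give the codes
-- x + y and x + (N ∸ y), from which (x,y) is recovered.
-- Lower bound: with at most three colours, two distinct vertices of the same colour with two
-- differently coloured common neighbours would already see every colour at distance 0 or 1,
-- so they would have equal codes. Hence in every unit square both diagonals are monochromatic,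
-- the colouring is 2-periodic in both directions and uses only two colours, and then (0,0)
-- and (1,1) have the same code.
module Submission where

open import Defs
open import Data.Nat using (ℕ; zero; suc; _+_; _*_; _∸_; _≤_; z≤n; s≤s; ∣_-_∣; _≤?_)
open import Data.Nat.Properties
  using (≤-trans; ≤-reflexive; ≤-antisym; ≤-pred; ≰⇒>; 1+n≰n; 1+n≢n; +-comm; +-suc; +-mono-≤;
         +-cancelˡ-≡; +-cancelʳ-≡; *-cancelˡ-≡; ∣-∣-triangle; ∣-∣-comm; ∣-∣-identityʳ; ∣n-n∣≡0;
         ∣m-m+n∣≡n; m≤n⇒∣m-n∣≡n∸m; m+[n∸m]≡n)
open import Data.Nat.Tactic.RingSolver using (solve-∀)
open import Data.Fin using (Fin; toℕ; fromℕ; inject₁)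
  renaming (zero to fzero; suc to fsuc)
open import Data.Fin.Properties
  using (_≟_; toℕ-inject₁; toℕ-fromℕ; toℕ≤pred[n]; toℕ-injective; injective⇒≤; suc-injective)
open import Data.Vec using (Vec; []; _∷_)
open import Data.Vec.Relation.Unary.All using ([]; _∷_)
open import Data.Vec.Relation.Unary.AllPairs using ([]; _∷_)
open import Data.Vec.Relation.Unary.Unique.Propositional using (Unique)
open import Data.Vec.Relation.Unary.Unique.Propositional.Properties using (lookup-injective)
open import Data.Product using (_×_; _,_; proj₁; proj₂; Σ; ∃₂; swap)
open import Data.Product.Properties using (≡-dec)
open import Data.Sum as Sum using (_⊎_; inj₁; inj₂; [_,_])
open import Data.Empty using (⊥-elim)
open import Function using (_∘_)
open import Function.Bundles using (_⇔_; mk⇔; Equivalence)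
open import Relation.Nullary using (¬_; yes; no; contradiction)
open import Relation.Binary.Definitions using (DecidableEquality)
open import Relation.Binary.PropositionalEquality
  using (_≡_; _≢_; refl; sym; trans; cong; cong₂; subst; ≢-sym; module ≡-Reasoning)

_++ʷ_ : ∀ {G u v w k l} → Walk G u v k → Walk G v w l → Walk G u w (k + l)
here     ++ʷ q = q
step e p ++ʷ q = step e (p ++ʷ q)

Symmetric : Graph → Set
Symmetric G = ∀ {u v} → Adj G u v → Adj G v u

Loopless : Graph → Set
Loopless G = ∀ {u v} → Adj G u v → u ≢ v

walk-reverse : ∀ {G u v l} → Symmetric G → Walk G u v l → Walk G v u l
walk-reverse G-sym here = here
walk-reverse {l = suc l} G-sym (step e p) =
  subst (Walk _ _ _) (+-comm l 1) (walk-reverse G-sym p ++ʷ step (G-sym e) here)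

-- Adj (P k) i j unfolds to Consecutive (toℕ i) (toℕ j).
Consecutive : ℕ → ℕ → Set
Consecutive x y = y ≡ suc x ⊎ x ≡ suc y

consecutive-∣-∣≡1 : ∀ {x y} → Consecutive x y → ∣ x - y ∣ ≡ 1
consecutive-∣-∣≡1 {x} (inj₁ refl) = trans (cong (∣ x -_∣) (+-comm 1 x)) (∣m-m+n∣≡n x 1)
consecutive-∣-∣≡1 {y = y} (inj₂ refl) =
  trans (∣-∣-comm (suc y) y) (consecutive-∣-∣≡1 {x = y} (inj₁ refl))

consecutive-+ˡ : ∀ z {x y} → Consecutive x y → Consecutive (z + x) (z + y)
consecutive-+ˡ z {x} {y} =
  Sum.map (λ e → trans (cong (z +_) e) (+-suc z x)) (λ e → trans (cong (z +_) e) (+-suc z y))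

consecutive-+ʳ : ∀ z {x y} → Consecutive x y → Consecutive (x + z) (y + z)
consecutive-+ʳ z = Sum.map (cong (_+ z)) (cong (_+ z))

P-symmetric : ∀ {k} → Symmetric (P k)
P-symmetric = Sum.swap

P-loopless : ∀ {k} → Loopless (P k)
P-loopless (inj₁ e) refl = 1+n≢n (sym e)
P-loopless (inj₂ e) refl = 1+n≢n (sym e)

P-step : ∀ {k} (i : Fin k) → Adj (P (suc k)) (inject₁ i) (fsuc i)
P-step i = inj₁ (cong suc (sym (toℕ-inject₁ i)))

P-walk-suc : ∀ {k} {i j : Fin k} {l} → Walk (P k) i j l → Walk (P (suc k)) (fsuc i) (fsuc j) l
P-walk-suc here       = here
P-walk-suc (step e p) = step (Sum.map (cong suc) (cong suc) e) (P-walk-suc p)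

P-walk-from-zero : ∀ {k} (j : Fin (suc k)) → Walk (P (suc k)) fzero j (toℕ j)
P-walk-from-zero fzero             = here
P-walk-from-zero {suc k} (fsuc j) = step (inj₁ refl) (P-walk-suc (P-walk-from-zero j))

P-walk : ∀ {k} (i j : Fin k) → Walk (P k) i j ∣ toℕ i - toℕ j ∣
P-walk fzero    j        = P-walk-from-zero j
P-walk (fsuc i) fzero    = walk-reverse P-symmetric (P-walk-from-zero (fsuc i))
P-walk (fsuc i) (fsuc j) = P-walk-suc (P-walk i j)

P-walk-length : ∀ {k} {i j : Fin k} {l} → Walk (P k) i j l → ∣ toℕ i - toℕ j ∣ ≤ l
P-walk-length {i = i} here = ≤-reflexive (∣n-n∣≡0 (toℕ i))
P-walk-length {i = i} {j} (step {w = w} e p) = begin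
  ∣ toℕ i - toℕ j ∣                     ≤⟨ ∣-∣-triangle (toℕ i) (toℕ w) (toℕ j) ⟩
  ∣ toℕ i - toℕ w ∣ + ∣ toℕ w - toℕ j ∣ ≡⟨ cong (_+ ∣ toℕ w - toℕ j ∣) (consecutive-∣-∣≡1 e) ⟩
  suc ∣ toℕ w - toℕ j ∣                 ≤⟨ s≤s (P-walk-length p) ⟩
  suc _                                 ∎
  where open Data.Nat.Properties.≤-Reasoning

P-dist : ∀ {k} (i j : Fin k) → IsDist (P k) i j ∣ toℕ i - toℕ j ∣
P-dist i j = P-walk i j , λ _ → P-walk-length

module _ {G H : Graph} where

  □-symmetric : Symmetric G → Symmetric H → Symmetric (G □ H)
  □-symmetric G-sym H-sym (inj₁ (refl , e)) = inj₁ (refl , H-sym e)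
  □-symmetric G-sym H-sym (inj₂ (e , refl)) = inj₂ (G-sym e , refl)

  □-loopless : Loopless G → Loopless H → Loopless (G □ H)
  □-loopless G-ll H-ll (inj₁ (_ , e)) = H-ll e ∘ cong proj₂
  □-loopless G-ll H-ll (inj₂ (e , _)) = G-ll e ∘ cong proj₁

  □-walk-left : ∀ {a a' l} (b : V H) → Walk G a a' l → Walk (G □ H) (a , b) (a' , b) l
  □-walk-left b here       = here
  □-walk-left b (step e p) = step (inj₂ (e , refl)) (□-walk-left b p)

  □-walk-right : ∀ {b b' l} (a : V G) → Walk H b b' l → Walk (G □ H) (a , b) (a , b') l
  □-walk-right a here       = here
  □-walk-right a (step e p) = step (inj₁ (refl , e)) (□-walk-right a p)

  □-walk-split : ∀ {a a' b b' l} → Walk (G □ H) (a , b) (a' , b') l →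
                 ∃₂ λ l₁ l₂ → l₁ + l₂ ≡ l × Walk G a a' l₁ × Walk H b b' l₂
  □-walk-split here = 0 , 0 , refl , here , here
  □-walk-split (step (inj₁ (refl , e)) p) with □-walk-split p
  ... | l₁ , l₂ , refl , pG , pH = l₁ , suc l₂ , +-suc l₁ l₂ , pG , step e pH
  □-walk-split (step (inj₂ (e , refl)) p) with □-walk-split p
  ... | l₁ , l₂ , refl , pG , pH = suc l₁ , l₂ , refl , step e pG , pH

  □-dist : ∀ {a a' b b' δ ε} → IsDist G a a' δ → IsDist H b b' ε →
           IsDist (G □ H) (a , b) (a' , b') (δ + ε)
  □-dist {a' = a'} {b} (pG , minG) (pH , minH) =
    □-walk-left b pG ++ʷ □-walk-right a' pH , shortest
    where
    shortest : ∀ l → Walk (G □ H) _ _ l → _ ≤ l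
    shortest l p with □-walk-split p
    ... | l₁ , l₂ , refl , pG' , pH' = +-mono-≤ (minG l₁ pG') (minH l₂ pH')

grid-dist : ∀ {m n} (a a' : Fin m) (b b' : Fin n) →
            IsDist (P m □ P n) (a , b) (a' , b') (∣ toℕ a - toℕ a' ∣ + ∣ toℕ b - toℕ b' ∣)
grid-dist a a' b b' = □-dist (P-dist a a') (P-dist b b')

module _ {G : Graph} {S : V G → Set} where

  setDist-unique : ∀ {v δ ε} → IsSetDist G v S δ → IsSetDist G v S ε → δ ≡ ε
  setDist-unique ((x , Sx , dx) , minδ) ((y , Sy , dy) , minε) =
    ≤-antisym (minδ y Sy _ dy) (minε x Sx _ dx)

  setDist-transfer : ∀ {u v d} → IsSetDist G u S d → IsSetDist G v S d →
                     ∀ δ → IsSetDist G u S δ ⇔ IsSetDist G v S δ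
  setDist-transfer {u} {v} du dv δ =
    mk⇔ (λ d → subst (IsSetDist G v S) (setDist-unique du d) dv)
        (λ d → subst (IsSetDist G u S) (setDist-unique dv d) du)

  setDist-empty : (∀ x → ¬ S x) → ∀ {v δ} → ¬ IsSetDist G v S δ
  setDist-empty empty ((x , Sx , _) , _) = empty x Sx

  setDist-zero : ∀ {v} → S v → IsSetDist G v S 0
  setDist-zero {v} Sv = (v , Sv , here , λ _ _ → z≤n) , λ _ _ _ _ → z≤n

  walk-leaving-length : ∀ {u x l} → ¬ S u → S x → Walk G u x l → 1 ≤ l
  walk-leaving-length ¬Su Sx here       = ⊥-elim (¬Su Sx)
  walk-leaving-length ¬Su Sx (step _ _) = s≤s z≤n

  setDist-one : ∀ {v w} → ¬ S v → Adj G v w → S w → IsSetDist G v S 1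
  setDist-one {w = w} ¬Sv e Sw =
    (w , Sw , step e here , λ _ → walk-leaving-length ¬Sv Sw) ,
    λ x Sx _ d → walk-leaving-length ¬Sv Sx (proj₁ d)

  setDist-singleton : ∀ {v z δ} → S z → (∀ x → S x → x ≡ z) → IsDist G v z δ → IsSetDist G v S δ
  setDist-singleton {v} {z} Sz unique d =
    (z , Sz , d) , λ x Sx ε dx → proj₂ d ε (subst (λ y → Walk G v y ε) (unique x Sx) (proj₁ dx))

HasNeighbourColoured : (G : Graph) {k : ℕ} → Coloring G k → V G → Fin k → Set
HasNeighbourColoured G c u i = Σ (V G) λ w → Adj G u w × c w ≡ i

NeighbourColoursShared : (G : Graph) {k : ℕ} → Coloring G k → V G → V G → Set
NeighbourColoursShared G c u v =
  ∀ i → i ≢ c u → (HasNeighbourColoured G c u i × HasNeighbourColoured G c v i) ⊎ (∀ x → c x ≢ i)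

module _ {G : Graph} {k : ℕ} {c : Coloring G k} where

  sameCode-from-neighbourhoods :
    IsProper G c → ∀ {u v} → c u ≡ c v → NeighbourColoursShared G c u v → SameCode G c u v
  sameCode-from-neighbourhoods proper {u} {v} cu≡cv seen i with i ≟ c u
  ... | yes refl = setDist-transfer (setDist-zero refl) (setDist-zero (sym cu≡cv))
  ... | no i≢cu with seen i i≢cu
  ...   | inj₁ ((w , uw , cw) , (w' , vw' , cw')) =
          setDist-transfer (setDist-one (off uw cw) uw cw) (setDist-one (off vw' cw') vw' cw')
    where
    off : ∀ {x y} → Adj G x y → c y ≡ i → c x ≢ i
    off e cy cx = proper _ _ e (trans cx (sym cy))
  ...   | inj₂ unused = λ δ → mk⇔ (⊥-elim ∘ setDist-empty unused) (⊥-elim ∘ setDist-empty unused)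

  sameCode-singleton-distance :
    ∀ {u v z i δ ε} → SameCode G c u v → c z ≡ i → (∀ x → c x ≡ i → x ≡ z) →
    IsDist G u z δ → IsDist G v z ε → δ ≡ ε
  sameCode-singleton-distance {i = i} {δ} sc cz unique du dv =
    setDist-unique (Equivalence.to (sc i δ) (setDist-singleton cz unique du))
                   (setDist-singleton cz unique dv)

unique⇒≤ : ∀ {n j} {xs : Vec (Fin j) n} → Unique xs → n ≤ j
unique⇒≤ u = injective⇒≤ (λ {i} {i'} → lookup-injective u i i')

three-distinct-cover : ∀ {j} → j ≤ 3 → {α β γ : Fin j} → α ≢ β → α ≢ γ → β ≢ γ →
                       ∀ i → i ≢ α → i ≡ β ⊎ i ≡ γ
three-distinct-cover j≤3 {α} {β} {γ} α≢β α≢γ β≢γ i i≢α with i ≟ β | i ≟ γ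
... | yes i≡β | _       = inj₁ i≡β
... | no _    | yes i≡γ = inj₂ i≡γ
... | no i≢β  | no i≢γ  = contradiction (≤-trans (unique⇒≤ distinct) j≤3) 1+n≰n
  where
  distinct : Unique (α ∷ β ∷ γ ∷ i ∷ [])
  distinct = (α≢β ∷ α≢γ ∷ ≢-sym i≢α ∷ [])
           ∷ (β≢γ ∷ ≢-sym i≢β ∷ [])
           ∷ (≢-sym i≢γ ∷ [])
           ∷ []
           ∷ []

module AtMostThreeColours {G : Graph} (G-sym : Symmetric G) {j : ℕ} (j≤3 : j ≤ 3)
                          {c : Coloring G j} (c-loc : IsLocating G c) where

  private
    proper : IsProper G c
    proper = proj₁ c-loc

    locating : ∀ u v → SameCode G c u v → u ≡ v
    locating = proj₂ c-loc

  common-neighbours-same-colour : ∀ {p q r s} → q ≢ s → c q ≡ c s →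
                                  Adj G q p → Adj G q r → Adj G s p → Adj G s r → c p ≡ c r
  common-neighbours-same-colour {p} {q} {r} {s} q≢s cq≡cs qp qr sp sr with c p ≟ c r
  ... | yes cp≡cr = cp≡cr
  ... | no cp≢cr = ⊥-elim (q≢s (locating q s (sameCode-from-neighbourhoods proper cq≡cs seen)))
    where
    seen : NeighbourColoursShared G c q s
    seen i i≢cq with three-distinct-cover j≤3 (proper q p qp) (proper q r qr) cp≢cr i i≢cq
    ... | inj₁ refl = inj₁ ((p , qp , refl) , (p , sp , refl))
    ... | inj₂ refl = inj₁ ((r , qr , refl) , (r , sr , refl))

  four-cycle-diagonals : ∀ {p q r s} → Adj G p q → Adj G q r → Adj G r s → Adj G s p →
                         p ≢ r → q ≢ s → c p ≡ c r × c q ≡ c s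
  four-cycle-diagonals {p} {q} {r} {s} pq qr rs sp p≢r q≢s with c q ≟ c s | c p ≟ c r
  ... | yes cq≡cs | _ =
    common-neighbours-same-colour q≢s cq≡cs (G-sym pq) qr sp (G-sym rs) , cq≡cs
  ... | no cq≢cs | yes cp≡cr =
    ⊥-elim (cq≢cs (common-neighbours-same-colour p≢r cp≡cr pq (G-sym sp) (G-sym qr) rs))
  ... | no cq≢cs | no cp≢cr
    with three-distinct-cover j≤3 (proper q p (G-sym pq)) (proper q r qr) cp≢cr (c s) (≢-sym cq≢cs)
  ...   | inj₁ cs≡cp = ⊥-elim (proper s p sp cs≡cp)
  ...   | inj₂ cs≡cr = ⊥-elim (proper r s rs (sym cs≡cr))

SquareDiagonals : ∀ {m n} {X : Set} → (Fin (suc (suc m)) × Fin (suc (suc n)) → X) → Set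
SquareDiagonals f = ∀ a b → f (inject₁ a , inject₁ b) ≡ f (fsuc a , fsuc b)
                          × f (fsuc a , inject₁ b) ≡ f (inject₁ a , fsuc b)

squareDiagonals-transpose : ∀ {m n X} {f : Fin (suc (suc m)) × Fin (suc (suc n)) → X} →
                            SquareDiagonals f → SquareDiagonals (f ∘ swap)
squareDiagonals-transpose diag b a = proj₁ (diag a b) , sym (proj₂ (diag a b))

squareDiagonals-rows : ∀ {m n X} {f : Fin (suc (suc m)) × Fin (suc (suc n)) → X} → SquareDiagonals f →
                       ∀ a b → f (fsuc (fsuc a) , b) ≡ f (inject₁ (inject₁ a) , b)
squareDiagonals-rows diag a fzero =
  trans (proj₂ (diag (fsuc a) fzero)) (sym (proj₁ (diag (inject₁ a) fzero)))
squareDiagonals-rows diag a (fsuc b) =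
  trans (sym (proj₁ (diag (fsuc a) b))) (proj₂ (diag (inject₁ a) b))

two-periodic-values : ∀ {k} {X : Set} (g : Fin (suc (suc k)) → X) →
                      (∀ i → g (fsuc (fsuc i)) ≡ g (inject₁ (inject₁ i))) →
                      ∀ i → g i ≡ g fzero ⊎ g i ≡ g (fsuc fzero)
two-periodic-values g periodic i = go (toℕ i) i refl
  where
  go : ∀ x i → toℕ i ≡ x → g i ≡ g fzero ⊎ g i ≡ g (fsuc fzero)
  go _ fzero _ = inj₁ refl
  go _ (fsuc fzero) _ = inj₂ refl
  go (suc (suc x)) (fsuc (fsuc i)) e =
    Sum.map (trans (periodic i)) (trans (periodic i)) (go x (inject₁ (inject₁ i)) smaller)
    where
    smaller : toℕ (inject₁ (inject₁ i)) ≡ x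
    smaller = trans (toℕ-inject₁ _) (trans (toℕ-inject₁ i) (cong (_∸ 2) e))

module _ {m n : ℕ} {X : Set} {f : Fin (suc (suc m)) × Fin (suc (suc n)) → X} (diag : SquareDiagonals f) where

  squareDiagonals-column-values : ∀ a b → f (a , b) ≡ f (a , fzero) ⊎ f (a , b) ≡ f (a , fsuc fzero)
  squareDiagonals-column-values a =
    two-periodic-values (λ b → f (a , b)) (λ b → squareDiagonals-rows {f = f ∘ swap} transposed b a)
    where
    transposed : SquareDiagonals (f ∘ swap)
    transposed = squareDiagonals-transpose {f = f} diag

  squareDiagonals-two-values : ∀ v → f v ≡ f (fzero , fzero) ⊎ f v ≡ f (fzero , fsuc fzero)
  squareDiagonals-two-values (a , b)
    with two-periodic-values (λ a → f (a , b)) (λ a → squareDiagonals-rows {f = f} diag a b) a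
  ... | inj₁ e = Sum.map (trans e) (trans e) (squareDiagonals-column-values fzero b)
  ... | inj₂ e = Sum.swap (Sum.map (λ e' → trans e (trans e' (proj₂ (diag fzero fzero))))
                                   (λ e' → trans e (trans e' (sym (proj₁ (diag fzero fzero)))))
                                   (squareDiagonals-column-values (fsuc fzero) b))

no-locating-three-colouring : ∀ {m n j} → j ≤ 3 → (c : Coloring (P (suc (suc m)) □ P (suc (suc n))) j) →
                              ¬ IsLocating (P (suc (suc m)) □ P (suc (suc n))) c
no-locating-three-colouring {m} {n} j≤3 c c-loc =
  contradiction (proj₂ c-loc (fzero , fzero) (fsuc fzero , fsuc fzero) same) λ ()
  where
  Grid : Graph
  Grid = P (suc (suc m)) □ P (suc (suc n))
  open AtMostThreeColours {Grid} (□-symmetric P-symmetric P-symmetric) j≤3 c-loc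

  diag : SquareDiagonals c
  diag a b = four-cycle-diagonals (inj₂ (P-step a , refl)) (inj₁ (refl , P-step b))
                                  (inj₂ (P-symmetric (P-step a) , refl)) (inj₁ (refl , P-symmetric (P-step b)))
                                  (P-loopless (P-step a) ∘ cong proj₁)
                                  (P-loopless (P-symmetric (P-step a)) ∘ cong proj₁)

  seen : NeighbourColoursShared Grid c (fzero , fzero) (fsuc fzero , fsuc fzero)
  seen i i≢A with i ≟ c (fzero , fsuc fzero)
  ... | yes refl = inj₁ (((fzero , fsuc fzero) , inj₁ (refl , inj₁ refl) , refl) ,
                         ((fzero , fsuc fzero) , inj₂ (inj₂ refl , refl) , refl))
  ... | no i≢B = inj₂ λ x cx≡i → [ i≢A ∘ trans (sym cx≡i) , i≢B ∘ trans (sym cx≡i) ]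
                                   (squareDiagonals-two-values diag x)

  same : SameCode Grid c (fzero , fzero) (fsuc fzero , fsuc fzero)
  same = sameCode-from-neighbourhoods (proj₁ c-loc) (proj₁ (diag fzero fzero)) seen

parity : ℕ → Fin 2
parity zero          = fzero
parity (suc zero)    = fsuc fzero
parity (suc (suc x)) = parity x

parity-suc : ∀ x → parity (suc x) ≢ parity x
parity-suc zero          ()
parity-suc (suc zero)    ()
parity-suc (suc (suc x)) = parity-suc x

consecutive-parity : ∀ {x y} → Consecutive x y → parity x ≢ parity y
consecutive-parity {x} (inj₁ refl) = parity-suc x ∘ sym
consecutive-parity {y = y} (inj₂ refl) = parity-suc y

coordinates-from-corner-distances : ∀ {N x y x' y'} → y ≤ N → y' ≤ N →
  x + y ≡ x' + y' → x + (N ∸ y) ≡ x' + (N ∸ y') → x ≡ x' × y ≡ y'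
coordinates-from-corner-distances {N} {x} {y} {x'} {y'} y≤N y'≤N d₀ d₁ =
  x≡x' , +-cancelˡ-≡ x y y' (trans d₀ (cong (_+ y') (sym x≡x')))
  where
  regroup : ∀ x y z → (x + y) + (x + z) ≡ 2 * x + (y + z)
  regroup = solve-∀
  sum-eliminates-y : ∀ {x y} → y ≤ N → (x + y) + (x + (N ∸ y)) ≡ 2 * x + N
  sum-eliminates-y {x} {y} y≤N = trans (regroup x y (N ∸ y)) (cong (2 * x +_) (m+[n∸m]≡n y≤N))
  x≡x' : x ≡ x'
  x≡x' = *-cancelˡ-≡ x x' 2 (+-cancelʳ-≡ N _ _ (begin
    2 * x + N                   ≡⟨ sum-eliminates-y {x} y≤N ⟨
    (x + y) + (x + (N ∸ y))     ≡⟨ cong₂ _+_ d₀ d₁ ⟩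
    (x' + y') + (x' + (N ∸ y')) ≡⟨ sum-eliminates-y {x'} y'≤N ⟩
    2 * x' + N                  ∎))
    where open ≡-Reasoning

module LocatingFourColouring (m n : ℕ) where

  Grid : Graph
  Grid = P (suc m) □ P (suc (suc n))

  corner₀ corner₁ : V Grid
  corner₀ = fzero , fzero
  corner₁ = fzero , fromℕ (suc n)

  rank : V Grid → ℕ
  rank (a , b) = toℕ a + toℕ b

  _≟ᵥ_ : DecidableEquality (V Grid)
  _≟ᵥ_ = ≡-dec _≟_ _≟_

  colouring : Coloring Grid 4
  colouring v with v ≟ᵥ corner₀ | v ≟ᵥ corner₁
  ... | yes _ | _     = fzero
  ... | no _  | yes _ = fsuc fzero
  ... | no _  | no _  = fsuc (fsuc (parity (rank v)))

  colouring-cases : ∀ v → (v ≡ corner₀ × colouring v ≡ fzero)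
                        ⊎ (v ≡ corner₁ × colouring v ≡ fsuc fzero)
                        ⊎ (v ≢ corner₁ × colouring v ≡ fsuc (fsuc (parity (rank v))))
  colouring-cases v with v ≟ᵥ corner₀ | v ≟ᵥ corner₁
  ... | yes v≡corner₀ | _             = inj₁ (v≡corner₀ , refl)
  ... | no _          | yes v≡corner₁ = inj₂ (inj₁ (v≡corner₁ , refl))
  ... | no _          | no v≢corner₁  = inj₂ (inj₂ (v≢corner₁ , refl))

  colouring-zero : ∀ v → colouring v ≡ fzero → v ≡ corner₀
  colouring-zero v c≡0 with colouring-cases v
  ... | inj₁ (v≡corner₀ , _)     = v≡corner₀
  ... | inj₂ (inj₁ (_ , c≡1))    = contradiction (trans (sym c≡1) c≡0) λ ()
  ... | inj₂ (inj₂ (_ , c≡par)) = contradiction (trans (sym c≡par) c≡0) λ ()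

  colouring-one : ∀ v → colouring v ≡ fsuc fzero → v ≡ corner₁
  colouring-one v c≡1 with colouring-cases v
  ... | inj₁ (_ , c≡0)           = contradiction (trans (sym c≡0) c≡1) λ ()
  ... | inj₂ (inj₁ (v≡corner₁ , _)) = v≡corner₁
  ... | inj₂ (inj₂ (_ , c≡par)) = contradiction (trans (sym c≡par) c≡1) λ ()

  colouring-corner₁ : colouring corner₁ ≡ fsuc fzero
  colouring-corner₁ with colouring-cases corner₁
  ... | inj₁ (() , _)
  ... | inj₂ (inj₁ (_ , c≡1))       = c≡1
  ... | inj₂ (inj₂ (corner₁≢corner₁ , _)) = contradiction refl corner₁≢corner₁

  alone-or-parity : ∀ v → (∀ w → colouring w ≡ colouring v → w ≡ v)
                        ⊎ colouring v ≡ fsuc (fsuc (parity (rank v)))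
  alone-or-parity v with colouring-cases v
  ... | inj₁ (refl , c≡0)       = inj₁ λ w cw≡cv → colouring-zero w (trans cw≡cv c≡0)
  ... | inj₂ (inj₁ (refl , c≡1)) = inj₁ λ w cw≡cv → colouring-one w (trans cw≡cv c≡1)
  ... | inj₂ (inj₂ (_ , c≡par)) = inj₂ c≡par

  rank-consecutive : ∀ {u v} → Adj Grid u v → Consecutive (rank u) (rank v)
  rank-consecutive {a , _} (inj₁ (refl , e)) = consecutive-+ˡ (toℕ a) e
  rank-consecutive {_ , b} (inj₂ (e , refl)) = consecutive-+ʳ (toℕ b) e

  proper : IsProper Grid colouring
  proper u v u~v cu≡cv with alone-or-parity u | alone-or-parity v
  ... | inj₁ u-alone | _ = □-loopless P-loopless P-loopless u~v (sym (u-alone v (sym cu≡cv)))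
  ... | _ | inj₁ v-alone = □-loopless P-loopless P-loopless u~v (v-alone u cu≡cv)
  ... | inj₂ cu | inj₂ cv =
    consecutive-parity (rank-consecutive u~v)
                       (suc-injective (suc-injective (trans (sym cu) (trans cu≡cv cv))))

  dist-corner₀ : ∀ v → IsDist Grid v corner₀ (toℕ (proj₁ v) + toℕ (proj₂ v))
  dist-corner₀ (a , b) =
    subst (IsDist Grid (a , b) corner₀) (cong₂ _+_ (∣-∣-identityʳ (toℕ a)) (∣-∣-identityʳ (toℕ b)))
          (grid-dist a fzero b fzero)

  dist-corner₁ : ∀ v → IsDist Grid v corner₁ (toℕ (proj₁ v) + (suc n ∸ toℕ (proj₂ v)))
  dist-corner₁ (a , b) =
    subst (IsDist Grid (a , b) corner₁) (cong₂ _+_ (∣-∣-identityʳ (toℕ a)) far)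
          (grid-dist a fzero b (fromℕ (suc n)))
    where
    far : ∣ toℕ b - toℕ (fromℕ (suc n)) ∣ ≡ suc n ∸ toℕ b
    far = trans (cong (∣ toℕ b -_∣) (toℕ-fromℕ (suc n))) (m≤n⇒∣m-n∣≡n∸m (toℕ≤pred[n] b))

  locating : ∀ u v → SameCode Grid colouring u v → u ≡ v
  locating u@(a , b) v@(a' , b') sc =
    cong₂ _,_ (toℕ-injective (proj₁ same)) (toℕ-injective (proj₂ same))
    where
    same : toℕ a ≡ toℕ a' × toℕ b ≡ toℕ b'
    same = coordinates-from-corner-distances (toℕ≤pred[n] b) (toℕ≤pred[n] b')
      (sameCode-singleton-distance sc refl colouring-zero (dist-corner₀ u) (dist-corner₀ v))
      (sameCode-singleton-distance sc colouring-corner₁ colouring-one (dist-corner₁ u) (dist-corner₁ v))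

  has-locating-colouring : HasLocatingColoring Grid 4
  has-locating-colouring = colouring , proper , locating

grid-needs-four-colours : ∀ {m n} j → HasLocatingColoring (P (suc (suc m)) □ P (suc (suc n))) j → 4 ≤ j
grid-needs-four-colours j (c , c-loc) with 4 ≤? j
... | yes 4≤j = 4≤j
... | no 4≰j  = ⊥-elim (no-locating-three-colouring (≤-pred (≰⇒> 4≰j)) c c-loc)

theorem1 : (m n : ℕ) → 2 ≤ m → m ≤ n → LocatingChromaticNumber (P m □ P n) 4
theorem1 (suc (suc m)) (suc (suc n)) (s≤s (s≤s z≤n)) (s≤s (s≤s _)) =
  LocatingFourColouring.has-locating-colouring (suc m) n , grid-needs-four-colours
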